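{- Let $w\in\Sigma_k$ and let $\Gamma$ be the quotient graph of some realizable partition of $\{s_0,\dots,s_{|w|}\}$. Then the smallest cardinality of a set of pairs generating $\Gamma$ equals $\chi(\Gamma)=e_\Gamma-v_\Gamma+1$.
   Context: $\Sigma_k$ is the set of finite (not necessarily reduced) words $w=g_{i_1}^{\alpha_1}\cdots g_{i_m}^{\alpha_m}$, $i_b\in\{1,\dots,k\}$, $\alpha_b\in\{1,-1\}$, with length $|w|=m$. To $w$ associate formal symbols $s_0,\dots,s_m$ and the trail $s_0\to s_1\to\cdots\to s_m$ whose $b$-th step is labeled $g_{i_b}^{\alpha_b}$. A partition of $\{s_0,\dots,s_m\}$ (write $s\equiv s'$ if in the same block) is realizable if for all $h,l$ with $i_h=i_l$: when $\alpha_h=\alpha_l$, $s_{h-1}\equiv s_{l-1}\iff s_h\equiv s_l$; when $\alpha_h=-\alpha_l$, $s_{h-1}\equiv s_l\iff s_h\equiv s_{l-1}$. Its quotient graph is the directed graph with edges colored in $\{1,\dots,k\}$ whose vertices are the blocks and which, for each $b$, has an edge of color $i_b$ from the block of $s_{b-1}$ to the block of $s_b$ if $\alpha_b=1$ (from the block of $s_b$ to that of $s_{b-1}$ if $\alpha_b=-1$), edges with the same color, tail and head being identified. $v_\Gamma,e_\Gamma$ denote numbers of vertices and edges. A set $S$ of unordered pairs of symbols generates $\Gamma$ if the partition of $\Gamma$ is the finest realizable partition in which each pair of $S$ lies in one block. -}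

module Defs where

open import Data.Nat as ℕ using (ℕ; suc)
open import Data.Fin using (Fin; inject₁) renaming (suc to fsuc)
open import Data.Fin.Properties using () renaming (_≟_ to _≟F_)
open import Data.Vec using (Vec; lookup)
open import Data.List using (List; map; deduplicate; length; allFin)
open import Data.List.Relation.Unary.All using (All)
open import Data.Product using (_×_; _,_; proj₁; proj₂)
open import Data.Product.Properties using (≡-dec)
open import Data.Integer as ℤ using (ℤ; +_)
open import Relation.Binary.PropositionalEquality using (_≡_)
open import Function.Bundles using (_⇔_)

data Sign : Set where
  plus minus : Sign

-- a word of length m over g_1^{±1},…,g_k^{±1}; letter b is (i_b , α_b)
Word : ℕ → ℕ → Set
Word k m = Vec (Fin k × Sign) m

-- symbols s_0,…,s_m are Fin (suc m).  A partition of the symbols is given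
-- by a labelling of symbols by block labels: s ≡ s' iff labels agree.
Partition : ℕ → Set
Partition m = Fin (suc m) → ℕ

module _ {k m : ℕ} (w : Word k m) where

  -- step b (0-indexed) goes from s_b (tail symbol) to s_{b+1} (head symbol)
  col : Fin m → Fin k
  col b = proj₁ (lookup w b)

  sgn : Fin m → Sign
  sgn b = proj₂ (lookup w b)

  src : Fin m → Fin (suc m)
  src b = inject₁ b

  tgt : Fin m → Fin (suc m)
  tgt b = fsuc b

  RealizableCond : Partition m → Fin m → Fin m → Sign → Sign → Set
  RealizableCond p h l plus  plus  = (p (src h) ≡ p (src l)) ⇔ (p (tgt h) ≡ p (tgt l))
  RealizableCond p h l minus minus = (p (src h) ≡ p (src l)) ⇔ (p (tgt h) ≡ p (tgt l))
  RealizableCond p h l plus  minus = (p (src h) ≡ p (tgt l)) ⇔ (p (tgt h) ≡ p (src l))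
  RealizableCond p h l minus plus  = (p (src h) ≡ p (tgt l)) ⇔ (p (tgt h) ≡ p (src l))

  Realizable : Partition m → Set
  Realizable p = ∀ (h l : Fin m) → col h ≡ col l → RealizableCond p h l (sgn h) (sgn l)

  vertexCount : Partition m → ℕ
  vertexCount p = length (deduplicate ℕ._≟_ (map p (allFin (suc m))))

  edgeOf : Partition m → Fin m → Fin k × ℕ × ℕ
  edgeOf p b with sgn b
  ... | plus  = col b , p (src b) , p (tgt b)
  ... | minus = col b , p (tgt b) , p (src b)

  -- edges of the quotient graph: distinct triples (identification of
  -- edges with same color, tail and head)
  edgeCount : Partition m → ℕ
  edgeCount p = length (deduplicate (≡-dec _≟F_ (≡-dec ℕ._≟_ ℕ._≟_)) (map (edgeOf p) (allFin m)))

  χ : Partition m → ℤ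
  χ p = (+ edgeCount p) ℤ.- (+ vertexCount p) ℤ.+ (+ 1)

  Merges : Partition m → List (Fin (suc m) × Fin (suc m)) → Set
  Merges p S = All (λ st → p (proj₁ st) ≡ p (proj₂ st)) S

  Refines : Partition m → Partition m → Set
  Refines p q = ∀ s s' → p s ≡ p s' → q s ≡ q s'

  Generates : Partition m → List (Fin (suc m) × Fin (suc m)) → Set
  Generates p S = Realizable p × Merges p S
                × (∀ q → Realizable q → Merges q S → Refines p q)

module Submission where

-- Read the trail backwards: the quotient graph of the suffix starting at
-- step b arises from that of the suffix starting at b+1 by adding the edge
-- of step b.  This edge is either already present (a repeated step), or new
-- with a new start vertex (a pendant step), or new between old vertices (a
-- closing step).  Only closing steps raise e - v + 1, so χ is the number of
-- closing steps (χ≡closingCount).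
--
-- Upper bound: the pairs (s_b , s_j) recording, for each closing step b, a
-- later symbol s_j in the block of s_b generate p (closingPairs-generate):
-- the finest realizable partition merging them also merges the start of each
-- repeated step with a later symbol, because realizable partitions are
-- exactly the folded ones (realizable⇒folded, folded⇒realizable).
--
-- Lower bound, by linear algebra over GF(2): a weighting x ∈ GF(2)^m of the
-- steps gives each edge the total weight of its steps and each symbol the
-- potential of the suffix starting there; splitting the blocks of p by
-- potential gives a realizable partition (split-realizable).  If |S| < χ,
-- the |S| conditions "the split merges S" and the m - χ conditions "x
-- vanishes off the closing steps" have a nonzero solution x
-- (kernel-nontrivial); a generating S then forces the potential to be
-- constant on the blocks of p, hence x = 0 (potential-separates).

open import Defs

open import Algebra.Bundles using (CommutativeRing)
open import Data.Bool using (Bool; true; false; _xor_; _∧_)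
open import Data.Bool.Properties
  using (xor-assoc; xor-same; xor-identityˡ; xor-identityʳ; ∧-zeroʳ; ∧-distribˡ-xor; xor-∧-commutativeRing)
open import Data.Empty using (⊥; ⊥-elim)
open import Data.Fin using (Fin; inject₁) renaming (zero to fzero; suc to fsuc)
open import Data.Fin.Properties using () renaming (_≟_ to _≟F_)
open import Data.Integer as ℤ using (ℤ; +_; _≤_; +≤+)
open import Data.Integer.Tactic.RingSolver using (solve-∀)
open import Data.List using (List; []; _∷_; _++_; length; map; filter; deduplicate; allFin)
open import Data.List.Properties using (map-tabulate; map-cong; length-map; length-++; filter-all)
open import Data.List.Membership.Propositional using (_∈_; _∉_)
open import Data.List.Membership.Propositional.Properties
  using (∈-map⁺; ∈-map⁻; ∈-allFin; ∈-deduplicate⁺; ∈-deduplicate⁻)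
open import Data.List.Membership.DecPropositional using () renaming (_∈?_ to member?)
open import Data.List.Relation.Unary.Any using (here; there)
open import Data.List.Relation.Unary.All as All using (All; []; _∷_)
open import Data.List.Relation.Unary.All.Properties using (++⁺; ++⁻; map⁺; map⁻)
open import Data.List.Relation.Unary.AllPairs using (_∷_)
open import Data.List.Relation.Unary.Unique.Propositional using (Unique)
open import Data.Nat as ℕ using (ℕ; zero; suc; _+_; _<_; ⌊_/2⌋; s≤s⁻¹)
open import Data.Nat.Properties using (_≤?_; ≰⇒>; ≤-refl; <-≤-trans; +-monoˡ-<; +-comm)
import Data.Nat.Properties
open import Data.Product using (Σ; ∃-syntax; _×_; _,_; proj₁; proj₂)
open import Data.Product.Properties using (≡-dec)
open import Data.Sum using (_⊎_; inj₁; inj₂)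
open import Data.Vec using (Vec; []; _∷_; lookup; zipWith; replicate)
open import Data.Vec.Properties using (lookup-zipWith; zipWith-identityˡ)
open import Function using (_∘_)
open import Function.Bundles using (mk⇔; Equivalence)
open import Relation.Binary.Definitions using (DecidableEquality)
open import Relation.Binary.PropositionalEquality
open import Relation.Nullary using (¬?; yes; no; does)

import Data.Integer.Properties as ℤP
open import Algebra.Properties.CommutativeSemigroup
  (CommutativeRing.+-commutativeSemigroup xor-∧-commutativeRing) using (interchange)
open import Algebra.Properties.CommutativeSemigroup
  Data.Nat.Properties.+-commutativeSemigroup using () renaming (interchange to +-interchange)

open ≡-Reasoning

module DistinctCount {A : Set} (_≟_ : DecidableEquality A) where
  open import Data.List.Relation.Unary.Unique.DecPropositional.Properties _≟_
    using (deduplicate-!)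

  private
    without : A → List A → List A
    without x = filter (¬? ∘ (x ≟_))

    without-member : ∀ x ys → Unique ys → x ∈ ys → suc (length (without x ys)) ≡ length ys
    without-member x (y ∷ ys) (x∉ys ∷ _) (here refl) with x ≟ x
    ... | no x≢x = ⊥-elim (x≢x refl)
    ... | yes _ = cong (suc ∘ length) (filter-all (¬? ∘ (x ≟_)) x∉ys)
    without-member x (y ∷ ys) (y∉ys ∷ u) (there x∈ys) with x ≟ y
    ... | yes refl = ⊥-elim (All.lookup y∉ys x∈ys refl)
    ... | no _ = cong suc (without-member x ys u x∈ys)

    without-nonmember : ∀ x ys → x ∉ ys → without x ys ≡ ys
    without-nonmember x ys x∉ys =
      filter-all (¬? ∘ (x ≟_)) (All.tabulate (λ y∈ys x≡y → x∉ys (subst (_∈ ys) (sym x≡y) y∈ys)))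

  distinct-∈ : ∀ x xs → x ∈ xs →
    length (deduplicate _≟_ (x ∷ xs)) ≡ length (deduplicate _≟_ xs)
  distinct-∈ x xs x∈xs =
    without-member x (deduplicate _≟_ xs) (deduplicate-! xs) (∈-deduplicate⁺ _≟_ x∈xs)

  distinct-∉ : ∀ x xs → x ∉ xs →
    length (deduplicate _≟_ (x ∷ xs)) ≡ suc (length (deduplicate _≟_ xs))
  distinct-∉ x xs x∉xs =
    cong (suc ∘ length) (without-nonmember x _ (x∉xs ∘ ∈-deduplicate⁻ _≟_ xs))

-- Linear algebra over GF(2): vectors are Vec Bool n with addition _⊕_.

_⊕_ : ∀ {n} → Vec Bool n → Vec Bool n → Vec Bool n
_⊕_ = zipWith _xor_

Functional : ℕ → Set
Functional n = Vec Bool n → Bool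

Linear : ∀ {n} → Functional n → Set
Linear f = ∀ x y → f (x ⊕ y) ≡ f x xor f y

Nonzero : ∀ {n} → Vec Bool n → Set
Nonzero x = ∃[ t ] lookup x t ≡ true

Vanishes : ∀ {n} → Vec Bool n → Functional n → Set
Vanishes x f = f x ≡ false

coordinate-linear : ∀ {n} (t : Fin n) → Linear (λ x → lookup x t)
coordinate-linear t x y = lookup-zipWith _xor_ t x y

e₀ : ∀ n → Vec Bool (suc n)
e₀ n = true ∷ replicate n false

record Pivot {n} (fs : List (Functional n)) (v : Vec Bool n) : Set where
  field
    pivot : Functional n
    others : List (Functional n)
    pivot-linear : Linear pivot
    others-linear : All Linear others
    pivot-at-v : pivot v ≡ true
    fewer : length others < length fs
    covers : ∀ y → Vanishes y pivot → All (Vanishes y) others → All (Vanishes y) fs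

choosePivot : ∀ {n} (fs : List (Functional n)) → All Linear fs → (v : Vec Bool n) →
  All (Vanishes v) fs ⊎ Pivot fs v
choosePivot [] [] v = inj₁ []
choosePivot (g ∷ gs) (lin-g ∷ lin-gs) v with g v in gv
... | true = inj₂ record
  { pivot = g ; others = gs ; pivot-linear = lin-g ; others-linear = lin-gs
  ; pivot-at-v = gv ; fewer = ℕ.s≤s ≤-refl
  ; covers = λ y gy gs-y → gy ∷ gs-y }
... | false with choosePivot gs lin-gs v
...   | inj₁ vanish = inj₁ (gv ∷ vanish)
...   | inj₂ piv = inj₂ record
  { pivot = pivot ; others = g ∷ others ; pivot-linear = pivot-linear
  ; others-linear = lin-g ∷ others-linear ; pivot-at-v = pivot-at-v ; fewer = ℕ.s≤s fewer
  ; covers = λ { y fy (gy ∷ rest) → gy ∷ covers y fy rest } }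
  where open Pivot piv

-- Eliminating the first coordinate with a functional f with f e₀ = 1: the
-- map ι y = f(0 ∷ y) ∷ y is additive, keeps vectors nonzero and lands in the
-- kernel of f, so equations restricted along ι have one unknown fewer.
module Eliminate {N} (f : Functional (suc N)) (lin-f : Linear f) (f-e₀ : f (e₀ N) ≡ true) where

  ι : Vec Bool N → Vec Bool (suc N)
  ι y = f (false ∷ y) ∷ y

  ι-additive : ∀ y z → ι (y ⊕ z) ≡ ι y ⊕ ι z
  ι-additive y z = cong (_∷ (y ⊕ z)) (lin-f (false ∷ y) (false ∷ z))

  -- if f(0 ∷ y) = 1 then ι y = e₀ ⊕ (0 ∷ y)
  ι-kernel : ∀ y → f (ι y) ≡ false
  ι-kernel y with f (false ∷ y) in f0y
  ... | false = f0y
  ... | true = begin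
    f (true ∷ y)
      ≡⟨ cong (λ z → f (true ∷ z)) (sym (zipWith-identityˡ xor-identityˡ y)) ⟩
    f (e₀ N ⊕ (false ∷ y))            ≡⟨ lin-f (e₀ N) (false ∷ y) ⟩
    f (e₀ N) xor f (false ∷ y)        ≡⟨ cong₂ _xor_ f-e₀ f0y ⟩
    false                             ∎

  ι-nonzero : ∀ {y} → Nonzero y → Nonzero (ι y)
  ι-nonzero (t , yt) = fsuc t , yt

  restrict-linear : ∀ {gs} → All Linear gs → All Linear (map (_∘ ι) gs)
  restrict-linear [] = []
  restrict-linear {g ∷ _} (lin-g ∷ lin-gs) =
    (λ y z → trans (cong g (ι-additive y z)) (lin-g (ι y) (ι z))) ∷ restrict-linear lin-gs

kernel-nontrivial : ∀ N (fs : List (Functional N)) → All Linear fs → length fs < N →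
  ∃[ x ] Nonzero x × All (Vanishes x) fs
kernel-nontrivial (suc N) fs lin fs<N with choosePivot fs lin (e₀ N)
... | inj₁ vanish = e₀ N , (fzero , refl) , vanish
... | inj₂ piv =
  let (y , y≢0 , vanish) = kernel-nontrivial N (map (_∘ ι) others) (restrict-linear others-linear)
                             (subst (_< N) (sym (length-map _ others)) (<-≤-trans fewer (s≤s⁻¹ fs<N)))
  in ι y , ι-nonzero y≢0 , covers (ι y) (ι-kernel y) (map⁻ vanish)
  where
  open Pivot piv
  open Eliminate pivot pivot-linear pivot-at-v

xor-cancelˡ : ∀ a b → a xor (a xor b) ≡ b
xor-cancelˡ a b = trans (sym (xor-assoc a a b)) (cong (_xor b) (xor-same a))

parity : ∀ {n} → (Fin n → Bool) → Bool
parity {zero} c = false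
parity {suc n} c = c fzero xor parity (c ∘ fsuc)

potential : ∀ {m} → (Fin m → Bool) → Fin (suc m) → Bool
potential c fzero = parity c
potential {suc m} c (fsuc j) = potential (c ∘ fsuc) j

potential-step : ∀ {m} (c : Fin m → Bool) b → potential c (inject₁ b) ≡ c b xor potential c (fsuc b)
potential-step c fzero = refl
potential-step c (fsuc b) = potential-step (c ∘ fsuc) b

potential-step′ : ∀ {m} (c : Fin m → Bool) b → potential c (fsuc b) ≡ c b xor potential c (inject₁ b)
potential-step′ c b =
  trans (sym (xor-cancelˡ (c b) _)) (cong (c b xor_) (sym (potential-step c b)))

potential-cong : ∀ {m} {c d : Fin m → Bool} → (∀ b → c b ≡ d b) → ∀ j → potential c j ≡ potential d j
potential-cong {zero} c≗d fzero = refl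
potential-cong {suc m} c≗d fzero = cong₂ _xor_ (c≗d fzero) (potential-cong (c≗d ∘ fsuc) fzero)
potential-cong {suc m} c≗d (fsuc j) = potential-cong (c≗d ∘ fsuc) j

potential-xor : ∀ {m} (c d : Fin m → Bool) j →
  potential (λ b → c b xor d b) j ≡ potential c j xor potential d j
potential-xor {zero} c d fzero = refl
potential-xor {suc m} c d fzero =
  trans (cong ((c fzero xor d fzero) xor_) (potential-xor (c ∘ fsuc) (d ∘ fsuc) fzero))
        (interchange (c fzero) (d fzero) _ _)
potential-xor {suc m} c d (fsuc j) = potential-xor (c ∘ fsuc) (d ∘ fsuc) j

potential-zero : ∀ {m} (c : Fin m → Bool) → (∀ b → c b ≡ false) → ∀ j → potential c j ≡ false
potential-zero {zero} c c≡0 fzero = refl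
potential-zero {suc m} c c≡0 fzero = cong₂ _xor_ (c≡0 fzero) (potential-zero (c ∘ fsuc) (c≡0 ∘ fsuc) fzero)
potential-zero {suc m} c c≡0 (fsuc j) = potential-zero (c ∘ fsuc) (c≡0 ∘ fsuc) j

parity-xor : ∀ {n} (c d : Fin n → Bool) → parity (λ b → c b xor d b) ≡ parity c xor parity d
parity-xor c d = potential-xor c d fzero

parity-cong : ∀ {n} {c d : Fin n → Bool} → (∀ b → c b ≡ d b) → parity c ≡ parity d
parity-cong c≗d = potential-cong c≗d fzero

parity-zero : ∀ {n} (c : Fin n → Bool) → (∀ b → c b ≡ false) → parity c ≡ false
parity-zero c c≡0 = potential-zero c c≡0 fzero

-- An injective coding of (block label, bit) as a block label.

code : ℕ → Bool → ℕ
code zero false = 0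
code zero true = 1
code (suc a) b = suc (suc (code a b))

lowBit : ℕ → Bool
lowBit zero = false
lowBit (suc zero) = true
lowBit (suc (suc n)) = lowBit n

half-code : ∀ a b → ⌊ code a b /2⌋ ≡ a
half-code zero false = refl
half-code zero true = refl
half-code (suc a) b = cong suc (half-code a b)

lowBit-code : ∀ a b → lowBit (code a b) ≡ b
lowBit-code zero false = refl
lowBit-code zero true = refl
lowBit-code (suc a) b = lowBit-code a b

code-injective : ∀ {a a' b b'} → code a b ≡ code a' b' → a ≡ a' × b ≡ b'
code-injective {a} {a'} {b} {b'} eq =
  trans (sym (half-code a b)) (trans (cong ⌊_/2⌋ eq) (half-code a' b')) ,
  trans (sym (lowBit-code a b)) (trans (cong lowBit eq) (lowBit-code a' b'))

Pair : ℕ → Set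
Pair m = Fin (suc m) × Fin (suc m)

EdgeLabel : ℕ → Set
EdgeLabel k = Fin k × ℕ × ℕ

edge≟ : ∀ {k} → DecidableEquality (EdgeLabel k)
edge≟ = ≡-dec _≟F_ (≡-dec ℕ._≟_ ℕ._≟_)

data End : Set where
  tailEnd headEnd : End

opposite : End → End
opposite tailEnd = headEnd
opposite headEnd = tailEnd

orient : ∀ {m} → Sign → End → Fin m → Fin (suc m)
orient plus tailEnd b = inject₁ b
orient plus headEnd b = fsuc b
orient minus tailEnd b = fsuc b
orient minus headEnd b = inject₁ b

module _ {k m : ℕ} (w : Word k m) where

  endpoint : End → Fin m → Fin (suc m)
  endpoint e b = orient (sgn w b) e b

  edgeOf-endpoints : ∀ p b → edgeOf w p b ≡ (col w b , p (endpoint tailEnd b) , p (endpoint headEnd b))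
  edgeOf-endpoints p b with sgn w b
  ... | plus = refl
  ... | minus = refl

  step-ends : ∀ b → Σ End λ e → endpoint e b ≡ inject₁ b × endpoint (opposite e) b ≡ fsuc b
  step-ends b with sgn w b
  ... | plus = tailEnd , refl , refl
  ... | minus = headEnd , refl , refl

  Folded : Partition m → Set
  Folded q = ∀ e h l → col w h ≡ col w l →
    q (endpoint (opposite e) h) ≡ q (endpoint (opposite e) l) → q (endpoint e h) ≡ q (endpoint e l)

  realizable⇒folded : ∀ {q} → Realizable w q → Folded q
  realizable⇒folded {q} real e h l same-col = condition (sgn w h) (sgn w l) e (real h l same-col)
    where
    condition : ∀ σ τ e → RealizableCond w q h l σ τ →
      q (orient σ (opposite e) h) ≡ q (orient τ (opposite e) l) → q (orient σ e h) ≡ q (orient τ e l)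
    condition plus plus tailEnd r = Equivalence.from r
    condition plus plus headEnd r = Equivalence.to r
    condition minus minus tailEnd r = Equivalence.to r
    condition minus minus headEnd r = Equivalence.from r
    condition plus minus tailEnd r = Equivalence.from r
    condition plus minus headEnd r = Equivalence.to r
    condition minus plus tailEnd r = Equivalence.to r
    condition minus plus headEnd r = Equivalence.from r

  folded⇒realizable : ∀ {q} → Folded q → Realizable w q
  folded⇒realizable {q} fold h l same-col =
    condition (sgn w h) (sgn w l) (fold tailEnd h l same-col) (fold headEnd h l same-col)
    where
    condition : ∀ σ τ →
      (q (orient σ headEnd h) ≡ q (orient τ headEnd l) → q (orient σ tailEnd h) ≡ q (orient τ tailEnd l)) →
      (q (orient σ tailEnd h) ≡ q (orient τ tailEnd l) → q (orient σ headEnd h) ≡ q (orient τ headEnd l)) →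
      RealizableCond w q h l σ τ
    condition plus plus toTail toHead = mk⇔ toHead toTail
    condition minus minus toTail toHead = mk⇔ toTail toHead
    condition plus minus toTail toHead = mk⇔ toHead toTail
    condition minus plus toTail toHead = mk⇔ toTail toHead

  same-edge⇒ : ∀ p h l → edgeOf w p h ≡ edgeOf w p l →
    col w h ≡ col w l × (∀ e → p (endpoint e h) ≡ p (endpoint e l))
  same-edge⇒ p h l eq = cong proj₁ labels , λ
    { tailEnd → cong (proj₁ ∘ proj₂) labels
    ; headEnd → cong (proj₂ ∘ proj₂) labels }
    where labels = trans (sym (edgeOf-endpoints p h)) (trans eq (edgeOf-endpoints p l))

  same-edge⇐ : ∀ p h l e → col w h ≡ col w l → p (endpoint e h) ≡ p (endpoint e l) →
    p (endpoint (opposite e) h) ≡ p (endpoint (opposite e) l) → edgeOf w p h ≡ edgeOf w p l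
  same-edge⇐ p h l e same-col at-e at-opposite =
    trans (edgeOf-endpoints p h) (trans (cong₂ _,_ same-col (ends e at-e at-opposite)) (sym (edgeOf-endpoints p l)))
    where
    ends : ∀ e → p (endpoint e h) ≡ p (endpoint e l) →
      p (endpoint (opposite e) h) ≡ p (endpoint (opposite e) l) →
      (p (endpoint tailEnd h) , p (endpoint headEnd h)) ≡ (p (endpoint tailEnd l) , p (endpoint headEnd l))
    ends tailEnd t h = cong₂ _,_ t h
    ends headEnd h t = cong₂ _,_ t h

  potential-across : ∀ (c : Fin m → Bool) e b →
    potential c (endpoint e b) ≡ c b xor potential c (endpoint (opposite e) b)
  potential-across c e b with sgn w b | e
  ... | plus | tailEnd = potential-step c b
  ... | minus | headEnd = potential-step c b
  ... | plus | headEnd = potential-step′ c b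
  ... | minus | tailEnd = potential-step′ c b

euler : ℕ → ℕ → ℤ
euler e v = + e ℤ.- + v ℤ.+ + 1

edges : ∀ {k m} → Word k m → Partition m → List (EdgeLabel k)
edges {m = m} w p = map (edgeOf w p) (allFin m)

blocks : ∀ {m} → Partition m → List ℕ
blocks {m} p = map p (allFin (suc m))

map-allFin-suc : ∀ {A : Set} {n} (f : Fin (suc n) → A) →
  map f (allFin (suc n)) ≡ f fzero ∷ map (f ∘ fsuc) (allFin n)
map-allFin-suc f = cong (f fzero ∷_) (trans (map-tabulate fsuc f) (sym (map-tabulate (λ i → i) (f ∘ fsuc))))

module _ {k m : ℕ} (a : Fin k × Sign) (w : Word k m) where

  endpoint-suc : ∀ e b → endpoint (a ∷ w) e (fsuc b) ≡ fsuc (endpoint w e b)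
  endpoint-suc e b with sgn w b | e
  ... | plus | tailEnd = refl
  ... | plus | headEnd = refl
  ... | minus | tailEnd = refl
  ... | minus | headEnd = refl

  edgeOf-suc : ∀ p b → edgeOf (a ∷ w) p (fsuc b) ≡ edgeOf w (p ∘ fsuc) b
  edgeOf-suc p b = begin
    edgeOf (a ∷ w) p (fsuc b)
      ≡⟨ edgeOf-endpoints (a ∷ w) p (fsuc b) ⟩
    (col w b , p (endpoint (a ∷ w) tailEnd (fsuc b)) , p (endpoint (a ∷ w) headEnd (fsuc b)))
      ≡⟨ cong₂ (λ u v → col w b , p u , p v) (endpoint-suc tailEnd b) (endpoint-suc headEnd b) ⟩
    (col w b , p (fsuc (endpoint w tailEnd b)) , p (fsuc (endpoint w headEnd b)))
      ≡⟨ sym (edgeOf-endpoints w (p ∘ fsuc) b) ⟩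
    edgeOf w (p ∘ fsuc) b ∎

  edges-suc : ∀ p → edges (a ∷ w) p ≡ edgeOf (a ∷ w) p fzero ∷ edges w (p ∘ fsuc)
  edges-suc p = trans (map-allFin-suc (edgeOf (a ∷ w) p))
    (cong (edgeOf (a ∷ w) p fzero ∷_) (map-cong (edgeOf-suc p) (allFin m)))

  realizable-suffix : ∀ {q} → Realizable (a ∷ w) q → Realizable w (q ∘ fsuc)
  realizable-suffix {q} real h l same-col = condition (sgn w h) (sgn w l) (real (fsuc h) (fsuc l) same-col)
    where
    condition : ∀ σ τ → RealizableCond (a ∷ w) q (fsuc h) (fsuc l) σ τ →
      RealizableCond w (q ∘ fsuc) h l σ τ
    condition plus plus r = r
    condition minus minus r = r
    condition plus minus r = r
    condition minus plus r = r

  refines-cons : ∀ {p q : Partition (suc m)} → Refines w (p ∘ fsuc) (q ∘ fsuc) →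
    (∀ t → p fzero ≡ p (fsuc t) → q fzero ≡ q (fsuc t)) → Refines (a ∷ w) p q
  refines-cons later first fzero fzero _ = refl
  refines-cons later first fzero (fsuc t) eq = first t eq
  refines-cons later first (fsuc s) fzero eq = sym (first s (sym eq))
  refines-cons later first (fsuc s) (fsuc t) eq = later s t eq

parity-masked-zero : ∀ {n} (d : Fin n → Bool) (x : Vec Bool n) → (∀ t → lookup x t ≡ false) →
  parity (λ t → d t ∧ lookup x t) ≡ false
parity-masked-zero d x x≡0 = parity-zero _ (λ t → trans (cong (d t ∧_) (x≡0 t)) (∧-zeroʳ (d t)))

xor-equal : ∀ a b → a xor b ≡ false → a ≡ b
xor-equal a b a+b≡0 = sym (begin
  b                ≡⟨ sym (xor-cancelˡ a b) ⟩
  a xor (a xor b)  ≡⟨ cong (a xor_) a+b≡0 ⟩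
  a xor false      ≡⟨ xor-identityʳ a ⟩
  a                ∎)

module Potential {k m : ℕ} (w : Word k m) (p : Partition m) where

  traverses : EdgeLabel k → Fin m → Bool
  traverses e t = does (edge≟ (edgeOf w p t) e)

  weightOf : Vec Bool m → EdgeLabel k → Bool
  weightOf x e = parity (λ t → traverses e t ∧ lookup x t)

  edgeWeight : Vec Bool m → Fin m → Bool
  edgeWeight x b = weightOf x (edgeOf w p b)

  height : Vec Bool m → Fin (suc m) → Bool
  height x = potential (edgeWeight x)

  -- refine each block of p by the potential
  split : Vec Bool m → Partition m
  split x s = code (p s) (height x s)

  height-linear : ∀ x y s → height (x ⊕ y) s ≡ height x s xor height y s
  height-linear x y s =
    trans (potential-cong edgeWeight-linear s) (potential-xor (edgeWeight x) (edgeWeight y) s)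
    where
    edgeWeight-linear : ∀ b → edgeWeight (x ⊕ y) b ≡ edgeWeight x b xor edgeWeight y b
    edgeWeight-linear b = trans
      (parity-cong λ t → trans (cong (on t ∧_) (lookup-zipWith _xor_ t x y)) (∧-distribˡ-xor (on t) _ _))
      (parity-xor (λ t → on t ∧ lookup x t) (λ t → on t ∧ lookup y t))
      where
      on = traverses (edgeOf w p b)

  edgeWeight-zero : ∀ x → (∀ t → lookup x t ≡ false) → ∀ b → edgeWeight x b ≡ false
  edgeWeight-zero x x≡0 b = parity-masked-zero (traverses (edgeOf w p b)) x x≡0

  split-realizable : Realizable w p → ∀ x → Realizable w (split x)
  split-realizable real x = folded⇒realizable w fold
    where
    fold : Folded w (split x)
    fold e h l same-col at-opposite = cong₂ code p-at-e (begin
      height x (endpoint w e h)                          ≡⟨ potential-across w _ e h ⟩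
      edgeWeight x h xor height x (endpoint w (opposite e) h)
        ≡⟨ cong₂ _xor_ same-weight (proj₂ opposite-codes) ⟩
      edgeWeight x l xor height x (endpoint w (opposite e) l) ≡⟨ sym (potential-across w _ e l) ⟩
      height x (endpoint w e l)                          ∎)
      where
      opposite-codes = code-injective at-opposite
      p-at-e = realizable⇒folded w real e h l same-col (proj₁ opposite-codes)
      same-weight = cong (weightOf x) (same-edge⇐ w p h l e same-col p-at-e (proj₁ opposite-codes))

  -- "the split by x merges s and t", as a linear condition on x
  mergeConstraint : Pair m → Functional m
  mergeConstraint (s , t) x = height x s xor height x t

  mergeConstraint-linear : ∀ st → Linear (mergeConstraint st)
  mergeConstraint-linear (s , t) x y = trans
    (cong₂ _xor_ (height-linear x y s) (height-linear x y t))
    (interchange (height x s) (height y s) (height x t) (height y t))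

  split-merges : ∀ {x} S → Merges w p S → All (Vanishes x) (map mergeConstraint S) → Merges w (split x) S
  split-merges [] [] [] = []
  split-merges {x} ((s , t) ∷ S) (p-eq ∷ merges) (vanish ∷ vanishes) =
    cong₂ code p-eq (xor-equal (height x s) (height x t) vanish) ∷ split-merges S merges vanishes

-- The three kinds of first step, relative to the graph of the later steps.

module FirstStep {k m : ℕ} (a : Fin k × Sign) (w : Word k m) (p : Partition (suc m)) where

  W : Word k (suc m)
  W = a ∷ w

  p′ : Partition m
  p′ = p ∘ fsuc

  firstEdge : EdgeLabel k
  firstEdge = edgeOf W p fzero

  data Kind : Set where
    repeated : firstEdge ∈ edges w p′ → Kind
    pendant : firstEdge ∉ edges w p′ → p fzero ∉ blocks p′ → Kind
    closing : firstEdge ∉ edges w p′ → (j : Fin (suc m)) → p fzero ≡ p (fsuc j) → Kind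

  kind : Kind
  kind with member? edge≟ firstEdge (edges w p′)
  ... | yes old = repeated old
  ... | no new with member? ℕ._≟_ (p fzero) (blocks p′)
  ...   | no fresh = pendant new fresh
  ...   | yes seen = let (j , _ , eq) = ∈-map⁻ p′ seen in closing new j eq

  repeated-partner : firstEdge ∈ edges w p′ →
    Σ (Fin (suc m)) λ u → p fzero ≡ p (fsuc u)
      × (∀ q → Folded W q → Refines w p′ (q ∘ fsuc) → q fzero ≡ q (fsuc u))
  repeated-partner old =
    endpoint w e b , at-start , λ q fold later → begin
      q fzero                         ≡⟨ cong q (sym leaves) ⟩
      q (endpoint W e fzero)          ≡⟨ fold e fzero (fsuc b) same-col (other-end q later) ⟩
      q (endpoint W e (fsuc b))       ≡⟨ cong q (endpoint-suc a w e b) ⟩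
      q (fsuc (endpoint w e b))       ∎
    where
    b = proj₁ (∈-map⁻ (edgeOf w p′) old)
    repeats : firstEdge ≡ edgeOf W p (fsuc b)
    repeats = trans (proj₂ (proj₂ (∈-map⁻ (edgeOf w p′) old))) (sym (edgeOf-suc a w p b))
    same-col = proj₁ (same-edge⇒ W p fzero (fsuc b) repeats)
    same-ends = proj₂ (same-edge⇒ W p fzero (fsuc b) repeats)
    e = proj₁ (step-ends W fzero)
    leaves = proj₁ (proj₂ (step-ends W fzero))
    enters = proj₂ (proj₂ (step-ends W fzero))
    at-start : p fzero ≡ p (fsuc (endpoint w e b))
    at-start = trans (cong p (sym leaves)) (trans (same-ends e) (cong p (endpoint-suc a w e b)))
    other-end : ∀ q → Refines w p′ (q ∘ fsuc) →
      q (endpoint W (opposite e) fzero) ≡ q (endpoint W (opposite e) (fsuc b))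
    other-end q later = begin
      q (endpoint W (opposite e) fzero)       ≡⟨ cong q enters ⟩
      q (fsuc fzero)                          ≡⟨ later fzero (endpoint w (opposite e) b) p-link ⟩
      q (fsuc (endpoint w (opposite e) b))    ≡⟨ cong q (sym (endpoint-suc a w (opposite e) b)) ⟩
      q (endpoint W (opposite e) (fsuc b))    ∎
      where
      p-link : p′ fzero ≡ p′ (endpoint w (opposite e) b)
      p-link = trans (cong p (sym enters))
        (trans (same-ends (opposite e)) (cong p (endpoint-suc a w (opposite e) b)))

  closingPair : Kind → List (Pair (suc m))
  closingPair (closing _ j _) = (fzero , fsuc j) ∷ []
  closingPair _ = []

  treeStep : Kind → List (Fin (suc m))
  treeStep (closing _ _ _) = []
  treeStep _ = fzero ∷ []

  one-step : ∀ c → length (treeStep c) + length (closingPair c) ≡ 1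
  one-step (repeated _) = refl
  one-step (pendant _ _) = refl
  one-step (closing _ _ _) = refl

  private
    module Edges = DistinctCount (edge≟ {k})
    module Blocks = DistinctCount ℕ._≟_

    edgeCount-cons : edgeCount W p ≡ length (deduplicate edge≟ (firstEdge ∷ edges w p′))
    edgeCount-cons = cong (length ∘ deduplicate edge≟) (edges-suc a w p)

    vertexCount-cons : vertexCount W p ≡ length (deduplicate ℕ._≟_ (p fzero ∷ blocks p′))
    vertexCount-cons = cong (length ∘ deduplicate ℕ._≟_) (map-allFin-suc p)

  χ-step : ∀ c → χ W p ≡ χ w p′ ℤ.+ + length (closingPair c)
  χ-step (repeated old) = begin
    euler (edgeCount W p) (vertexCount W p)
      ≡⟨ cong₂ euler (trans edgeCount-cons (Edges.distinct-∈ _ _ old))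
                     (trans vertexCount-cons (Blocks.distinct-∈ _ _ seen)) ⟩
    χ w p′          ≡⟨ sym (ℤP.+-identityʳ _) ⟩
    χ w p′ ℤ.+ + 0  ∎
    where
    partner = repeated-partner old
    seen = subst (_∈ blocks p′) (sym (proj₁ (proj₂ partner))) (∈-map⁺ p′ (∈-allFin (proj₁ partner)))
  χ-step (pendant new fresh) = begin
    euler (edgeCount W p) (vertexCount W p)
      ≡⟨ cong₂ euler (trans edgeCount-cons (Edges.distinct-∉ _ _ new))
                     (trans vertexCount-cons (Blocks.distinct-∉ _ _ fresh)) ⟩
    euler (suc (edgeCount w p′)) (suc (vertexCount w p′))
      ≡⟨ new-edge-and-vertex (+ edgeCount w p′) (+ vertexCount w p′) ⟩
    χ w p′ ℤ.+ + 0  ∎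
    where
    new-edge-and-vertex : ∀ x y → (+ 1 ℤ.+ x) ℤ.- (+ 1 ℤ.+ y) ℤ.+ + 1 ≡ (x ℤ.- y ℤ.+ + 1) ℤ.+ + 0
    new-edge-and-vertex = solve-∀
  χ-step (closing new j eq) = begin
    euler (edgeCount W p) (vertexCount W p)
      ≡⟨ cong₂ euler (trans edgeCount-cons (Edges.distinct-∉ _ _ new))
                     (trans vertexCount-cons (Blocks.distinct-∈ _ _ seen)) ⟩
    euler (suc (edgeCount w p′)) (vertexCount w p′)
      ≡⟨ new-edge (+ edgeCount w p′) (+ vertexCount w p′) ⟩
    χ w p′ ℤ.+ + 1  ∎
    where
    seen = subst (_∈ blocks p′) (sym eq) (∈-map⁺ p′ (∈-allFin j))
    new-edge : ∀ x y → (+ 1 ℤ.+ x) ℤ.- y ℤ.+ + 1 ≡ (x ℤ.- y ℤ.+ + 1) ℤ.+ + 1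
    new-edge = solve-∀

  weight-later : ∀ x0 x′ → (x0 ≡ true → firstEdge ∉ edges w p′) → ∀ b →
    Potential.edgeWeight W p (x0 ∷ x′) (fsuc b) ≡ Potential.edgeWeight w p′ x′ b
  weight-later x0 x′ new b = cong₂ _xor_ (first-term x0 new)
    (parity-cong λ t → cong₂ (λ u v → does (edge≟ u v) ∧ lookup x′ t)
                             (edgeOf-suc a w p t) (edgeOf-suc a w p b))
    where
    first-term : ∀ x0 → (x0 ≡ true → firstEdge ∉ edges w p′) →
      does (edge≟ firstEdge (edgeOf W p (fsuc b))) ∧ x0 ≡ false
    first-term false _ = ∧-zeroʳ _
    first-term true new with edge≟ firstEdge (edgeOf W p (fsuc b))
    ... | yes same = ⊥-elim (new refl
          (subst (_∈ edges w p′) (sym (trans same (edgeOf-suc a w p b))) (∈-map⁺ _ (∈-allFin b))))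
    ... | no _ = refl

  height-later : ∀ x0 x′ → (x0 ≡ true → firstEdge ∉ edges w p′) → ∀ s →
    Potential.height W p (x0 ∷ x′) (fsuc s) ≡ Potential.height w p′ x′ s
  height-later x0 x′ new = potential-cong (weight-later x0 x′ new)

  weight-first : ∀ x0 x′ → (∀ t → lookup x′ t ≡ false) → Potential.edgeWeight W p (x0 ∷ x′) fzero ≡ x0
  weight-first x0 x′ x′≡0 = begin
    does (edge≟ firstEdge firstEdge) ∧ x0 xor _
      ≡⟨ cong₂ _xor_ (diagonal x0) (parity-masked-zero (Potential.traverses W p firstEdge ∘ fsuc) x′ x′≡0) ⟩
    x0 xor false                                 ≡⟨ xor-identityʳ x0 ⟩
    x0                                           ∎
    where
    diagonal : ∀ x0 → does (edge≟ firstEdge firstEdge) ∧ x0 ≡ x0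
    diagonal x0 with edge≟ firstEdge firstEdge
    ... | yes _ = refl
    ... | no ≢ = ⊥-elim (≢ refl)

  weighted⇒new : ∀ {x0 x′} c → All (λ b → lookup (x0 ∷ x′) b ≡ false) (treeStep c) →
    x0 ≡ true → firstEdge ∉ edges w p′
  weighted⇒new (repeated _) (() ∷ []) refl
  weighted⇒new (pendant _ _) (() ∷ []) refl
  weighted⇒new (closing new _ _) _ _ = new

  -- if the later weights vanish and the potential is constant on blocks,
  -- the first step is unweighted: a weighted closing step would make the
  -- potential jump between s_0 and its later partner s_{j+1}
  first-unweighted : ∀ {x0 x′} c → All (λ b → lookup (x0 ∷ x′) b ≡ false) (treeStep c) →
    (∀ t → lookup x′ t ≡ false) →
    (∀ s s′ → p s ≡ p s′ → Potential.height W p (x0 ∷ x′) s ≡ Potential.height W p (x0 ∷ x′) s′) →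
    x0 ≡ false
  first-unweighted (repeated _) (x0≡0 ∷ []) _ _ = x0≡0
  first-unweighted (pendant _ _) (x0≡0 ∷ []) _ _ = x0≡0
  first-unweighted {x0} {x′} (closing new j eq) _ x′≡0 constant = begin
    x0                                 ≡⟨ sym (xor-identityʳ x0) ⟩
    x0 xor false                       ≡⟨ cong₂ _xor_ (sym (weight-first x0 x′ x′≡0)) (sym (later-flat fzero)) ⟩
    edgeWeight x fzero xor height x (fsuc fzero) ≡⟨ sym (potential-step (edgeWeight x) fzero) ⟩
    height x fzero                     ≡⟨ constant fzero (fsuc j) eq ⟩
    height x (fsuc j)                  ≡⟨ later-flat j ⟩
    false                              ∎
    where
    open Potential W p
    x = x0 ∷ x′
    later-flat : ∀ s → height x (fsuc s) ≡ false
    later-flat s = trans (height-later x0 x′ (λ _ → new) s)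
      (potential-zero _ (Potential.edgeWeight-zero w p′ x′ x′≡0) s)

shift : ∀ {m} → Pair m → Pair (suc m)
shift (s , t) = fsuc s , fsuc t

closingPairs : ∀ {k m} → Word k m → Partition m → List (Pair m)
closingPairs [] p = []
closingPairs (a ∷ w) p = closingPair kind ++ map shift (closingPairs w p′)
  where open FirstStep a w p

treeSteps : ∀ {k m} → Word k m → Partition m → List (Fin m)
treeSteps [] p = []
treeSteps (a ∷ w) p = treeStep kind ++ map fsuc (treeSteps w p′)
  where open FirstStep a w p

length-prefix : ∀ {A B : Set} {f : B → A} (xs : List A) ys → length (xs ++ map f ys) ≡ length xs + length ys
length-prefix xs ys = trans (length-++ xs) (cong (λ n → length xs + n) (length-map _ ys))

count-steps : ∀ {k m} (w : Word k m) p → length (treeSteps w p) + length (closingPairs w p) ≡ m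
count-steps [] p = refl
count-steps {m = suc m} (a ∷ w) p = begin
  length (treeStep kind ++ map fsuc T) + length (closingPair kind ++ map shift C)
    ≡⟨ cong₂ _+_ (length-prefix (treeStep kind) T) (length-prefix (closingPair kind) C) ⟩
  (length (treeStep kind) + length T) + (length (closingPair kind) + length C)
    ≡⟨ +-interchange (length (treeStep kind)) (length T) _ _ ⟩
  (length (treeStep kind) + length (closingPair kind)) + (length T + length C)
    ≡⟨ cong₂ _+_ (one-step kind) (count-steps w p′) ⟩
  suc m ∎
  where
  open FirstStep a w p
  T = treeSteps w p′
  C = closingPairs w p′

χ≡closingCount : ∀ {k m} (w : Word k m) p → χ w p ≡ + length (closingPairs w p)
χ≡closingCount [] p = refl
χ≡closingCount (a ∷ w) p = begin
  χ (a ∷ w) p                                             ≡⟨ χ-step kind ⟩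
  χ w p′ ℤ.+ + length (closingPair kind)
    ≡⟨ cong (ℤ._+ + length (closingPair kind)) (χ≡closingCount w p′) ⟩
  + (length (closingPairs w p′) + length (closingPair kind))
    ≡⟨ cong +_ (+-comm _ (length (closingPair kind))) ⟩
  + (length (closingPair kind) + length (closingPairs w p′))
    ≡⟨ cong +_ (sym (length-prefix (closingPair kind) (closingPairs w p′))) ⟩
  + length (closingPairs (a ∷ w) p)                       ∎
  where open FirstStep a w p

-- Upper bound: the closing pairs generate p.

closingPairs-merge : ∀ {k m} (w : Word k m) p → Merges w p (closingPairs w p)
closingPairs-merge [] p = []
closingPairs-merge (a ∷ w) p = ++⁺ (first kind) (map⁺ (closingPairs-merge w p′))
  where
  open FirstStep a w p
  first : ∀ c → Merges W p (closingPair c)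
  first (repeated _) = []
  first (pendant _ _) = []
  first (closing _ _ eq) = eq ∷ []

closingPairs-finest : ∀ {k m} (w : Word k m) p q → Realizable w q → Merges w q (closingPairs w p) →
  Refines w p q
closingPairs-finest [] p q _ _ fzero fzero _ = refl
closingPairs-finest (a ∷ w) p q real merges = refines-cons a w later (first kind (proj₁ split-merges))
  where
  open FirstStep a w p
  split-merges = ++⁻ (closingPair kind) merges
  later : Refines w p′ (q ∘ fsuc)
  later = closingPairs-finest w p′ (q ∘ fsuc) (realizable-suffix a w real) (map⁻ (proj₂ split-merges))
  first : ∀ c → Merges W q (closingPair c) → ∀ t → p fzero ≡ p (fsuc t) → q fzero ≡ q (fsuc t)
  first (repeated old) _ t eq =
    let (u , p-partner , q-partner) = repeated-partner old
    in trans (q-partner q (realizable⇒folded W real) later) (later u t (trans (sym p-partner) eq))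
  first (pendant _ fresh) _ t eq = ⊥-elim (fresh (subst (_∈ blocks p′) (sym eq) (∈-map⁺ p′ (∈-allFin t))))
  first (closing _ j eq′) (q-closing ∷ []) t eq = trans q-closing (later j t (trans (sym eq′) eq))

closingPairs-generate : ∀ {k m} (w : Word k m) p → Realizable w p → Generates w p (closingPairs w p)
closingPairs-generate w p real = real , closingPairs-merge w p , λ q → closingPairs-finest w p q

-- Lower bound.

potential-separates : ∀ {k m} (w : Word k m) p x → All (λ b → lookup x b ≡ false) (treeSteps w p) →
  (∀ s s′ → p s ≡ p s′ → Potential.height w p x s ≡ Potential.height w p x s′) →
  ∀ t → lookup x t ≡ false
potential-separates (a ∷ w) p (x0 ∷ x′) vanish constant = λ
  { fzero → first-unweighted kind first-vanish later-zero constant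
  ; (fsuc t) → later-zero t }
  where
  open FirstStep a w p
  first-vanish = proj₁ (++⁻ (treeStep kind) vanish)
  new = weighted⇒new kind first-vanish
  later-zero : ∀ t → lookup x′ t ≡ false
  later-zero = potential-separates w p′ x′ (map⁻ (proj₂ (++⁻ (treeStep kind) vanish))) λ s s′ eq →
    trans (sym (height-later x0 x′ new s)) (trans (constant (fsuc s) (fsuc s′) eq) (height-later x0 x′ new s′))

-- Every generating set has at least χ pairs: otherwise a nonzero weighting
-- satisfies all the merge and tree-step constraints, which is impossible.
lower-bound : ∀ {k m} (w : Word k m) p → Realizable w p → ∀ S → Generates w p S →
  length (closingPairs w p) ℕ.≤ length S
lower-bound {m = m} w p real S (_ , merges , finest) with length (closingPairs w p) ≤? length S
... | yes enough = enough
... | no too-few =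
  let (x , (t , x-t) , vanish) = kernel-nontrivial m constraints constraints-linear fewer
      (merge-vanish , tree-vanish) = ++⁻ (map mergeConstraint S) vanish
      refines = finest (split x) (split-realizable real x) (split-merges S merges merge-vanish)
      constant = λ s s′ eq → proj₂ (code-injective (refines s s′ eq))
  in ⊥-elim (false≢true (trans (sym (potential-separates w p x (map⁻ tree-vanish) constant t)) x-t))
  where
  open Potential w p
  T = treeSteps w p
  constraints : List (Functional m)
  constraints = map mergeConstraint S ++ map (λ b x → lookup x b) T
  constraints-linear : All Linear constraints
  constraints-linear =
    ++⁺ (map⁺ (All.universal mergeConstraint-linear S)) (map⁺ (All.universal coordinate-linear T))
  fewer : length constraints < m
  fewer = subst (_< m)
    (sym (trans (length-++ (map mergeConstraint S)) (cong₂ _+_ (length-map _ S) (length-map _ T))))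
    (subst (length S + length T <_) (trans (+-comm _ (length T)) (count-steps w p))
      (+-monoˡ-< (length T) (≰⇒> too-few)))
  false≢true : false ≡ true → ⊥
  false≢true ()

lemma2 : ∀ (k m : ℕ) (w : Word k m) (p : Partition m) → Realizable w p →
    Σ (List (Fin (suc m) × Fin (suc m))) (λ S → Generates w p S × (+ length S ≡ χ w p))
    × (∀ (S : List (Fin (suc m) × Fin (suc m))) → Generates w p S → χ w p ≤ + length S)
lemma2 k m w p real =
  (closingPairs w p , closingPairs-generate w p real , sym (χ≡closingCount w p)) ,
  λ S generates → subst (_≤ + length S) (sym (χ≡closingCount w p)) (+≤+ (lower-bound w p real S generates))
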